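{- Let $P,Q\in\mathbb Z$ with $Q\ne0$, $f(t)=t^2-Pt+Q$, $D=P^2-4Q\ne0$, and let $p$ be a prime with $p\nmid Q$. Then (1) $\rho:G_{\mathbb Z_{(p)}}(f)\to K(f,p)$, $[w_1:w_0]\mapsto[w_1:w_0]$, is a group isomorphism; and (2) it induces a group isomorphism $\rho^*:G^*_{\mathbb Z_{(p)}}(f)\to K^*(f,p)$, $[w_1:w_0]\bmod\langle[0:1]\rangle\mapsto[w_1:w_0]\bmod\langle[0:1]\rangle$.
   Context: For $R\in\{\mathbb Q,\mathbb Z_{(p)}\}$, $\mathscr S(f,R)^{\times}$ is the set of sequences $(w_n)_{n\in\mathbb Z}$ in $R$ with $w_{n+2}-Pw_{n+1}+Qw_n=0$ and $\Lambda(w_1,w_0):=w_1^2-Pw_0w_1+Qw_0^2\in R^\times$, a group under $(w_n)*(v_n)=(u_n)$, $u_1=w_1v_1-Qw_0v_0$, $u_0=w_0v_1+w_1v_0-Pw_0v_0$. $G_R(f)$ is its quotient by ${\bf w}\sim{\bf v}\iff w_n=\lambda v_n\ \forall n$ ($\lambda\in R^\times$); $G^*_R(f)$ its quotient by $w_n=\lambda v_{n+\nu}\ \forall n$ ($\lambda\in R^\times,\nu\in\mathbb Z$), and $G^*_R(f)\cong G_R(f)/\langle[0:1]\rangle$; $[w_1:w_0]$ denotes the class with initial terms $w_1,w_0$. $K(f,p)\le G_{\mathbb Q}(f)$ is the set of classes having a representative with $w_0,w_1\in\mathbb Z$ coprime and $p\nmid\Lambda(w_1,w_0)$, and $K^*(f,p)$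 is its image in $G^*_{\mathbb Q}(f)$, identified with $K(f,p)/\langle[0:1]\rangle$. -}

module Defs where

open import Data.Nat as ℕ using (ℕ; zero; suc)
open import Data.Nat.Primality using (Prime)
open import Data.Nat.Coprimality using (Coprime)
open import Data.Nat.Divisibility as ℕD using ()
open import Data.Integer as ℤ using (ℤ; +_; -[1+_]; ∣_∣)
open import Data.Integer.Divisibility as ℤD using ()
open import Data.Rational as ℚ using (ℚ; 0ℚ; 1ℚ; _+_; _*_; _-_; 1/_)
open import Data.Rational.Properties using (_≟_)
open import Data.Product using (Σ; ∃; _×_; _,_; proj₁; proj₂)
open import Data.Unit using (⊤)
open import Relation.Nullary using (¬_; yes; no)
open import Relation.Binary.PropositionalEquality using (_≡_; _≢_)

SubRing : Set₁
SubRing = ℚ → Set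

ℚ-all : SubRing
ℚ-all _ = ⊤

ℤ₍_₎ : ℕ → SubRing
ℤ₍ p ₎ x = ¬ (p ℕD.∣ ℚ.denominatorℕ x)

IsUnit : SubRing → ℚ → Set
IsUnit R x = Σ ℚ λ y → R x × R y × (x * y ≡ 1ℚ)

ι : ℤ → ℚ
ι z = z ℚ./ 1

Seq : Set
Seq = ℤ → ℚ

Λ : ℤ → ℤ → ℚ → ℚ → ℚ
Λ P Q w₁ w₀ = w₁ * w₁ - ι P * w₀ * w₁ + ι Q * w₀ * w₀

Λℤ : ℤ → ℤ → ℤ → ℤ → ℤ
Λℤ P Q w₁ w₀ = w₁ ℤ.* w₁ ℤ.- P ℤ.* w₀ ℤ.* w₁ ℤ.+ Q ℤ.* w₀ ℤ.* w₀

InS : ℤ → ℤ → SubRing → Seq → Set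
InS P Q R w =
  (∀ n → R (w n)) ×
  (∀ n → w (n ℤ.+ + 2) - ι P * w (n ℤ.+ + 1) + ι Q * w n ≡ 0ℚ) ×
  IsUnit R (Λ P Q (w (+ 1)) (w (+ 0)))

-- The unique sequence with w₁ = a, w₀ = b satisfying the recurrence
-- (going backwards needs Q⁻¹; Q ≠ 0 is assumed wherever this is used).

invℚ : ℚ → ℚ
invℚ q with q ≟ 0ℚ
... | yes _ = 0ℚ
... | no q≢0 = 1/_ q {{ℚ.≢-nonZero q≢0}}

private
  -- fw n = (w_n , w_{n+1})
  fw : ℤ → ℤ → ℚ → ℚ → ℕ → ℚ × ℚ
  fw P Q a b zero = b , a
  fw P Q a b (suc n) with fw P Q a b n
  ... | x , y = y , (ι P * y - ι Q * x)

  -- bw n = (w_{-n} , w_{-n+1})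
  bw : ℤ → ℤ → ℚ → ℚ → ℕ → ℚ × ℚ
  bw P Q a b zero = b , a
  bw P Q a b (suc n) with bw P Q a b n
  ... | x , y = ((ι P * x - y) * invℚ (ι Q)) , x

gen : ℤ → ℤ → ℚ → ℚ → Seq
gen P Q a b (+ n) = proj₁ (fw P Q a b n)
gen P Q a b -[1+ n ] = proj₁ (bw P Q a b (suc n))

mul : ℤ → ℤ → Seq → Seq → Seq
mul P Q w v = gen P Q
  (w (+ 1) * v (+ 1) - ι Q * w (+ 0) * v (+ 0))
  (w (+ 0) * v (+ 1) + w (+ 1) * v (+ 0) - ι P * w (+ 0) * v (+ 0))

G-eq : SubRing → Seq → Seq → Set
G-eq R w v = Σ ℚ λ c → IsUnit R c × (∀ n → w n ≡ c * v n)

G*-eq : SubRing → Seq → Seq → Set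
G*-eq R w v = Σ ℚ λ c → IsUnit R c × Σ ℤ λ ν → (∀ n → w n ≡ c * v (n ℤ.+ ν))

InK : ℤ → ℤ → ℕ → Seq → Set
InK P Q p w = Σ Seq λ v → InS P Q ℚ-all v × G-eq ℚ-all w v ×
  Σ ℤ λ a → Σ ℤ λ b → v (+ 1) ≡ ι a × v (+ 0) ≡ ι b ×
    Coprime ∣ a ∣ ∣ b ∣ × ¬ ((+ p) ℤD.∣ Λℤ P Q a b)

record ρ-IsIso (P Q : ℤ) (p : ℕ) : Set where
  field
    into-K : ∀ w → InS P Q ℤ₍ p ₎ w → InK P Q p w
    well-defined : ∀ w v → InS P Q ℤ₍ p ₎ w → InS P Q ℤ₍ p ₎ v →
      G-eq ℤ₍ p ₎ w v → G-eq ℚ-all w v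
    homomorphism : ∀ w v → InS P Q ℤ₍ p ₎ w → InS P Q ℤ₍ p ₎ v →
      G-eq ℚ-all (mul P Q w v) (mul P Q w v)
    injective : ∀ w v → InS P Q ℤ₍ p ₎ w → InS P Q ℤ₍ p ₎ v →
      G-eq ℚ-all w v → G-eq ℤ₍ p ₎ w v
    surjective : ∀ w → InS P Q ℚ-all w → InK P Q p w →
      Σ Seq λ v → InS P Q ℤ₍ p ₎ v × G-eq ℚ-all v w

record ρ*-IsIso (P Q : ℤ) (p : ℕ) : Set where
  field
    into-K* : ∀ w → InS P Q ℤ₍ p ₎ w → InK P Q p w
    well-defined : ∀ w v → InS P Q ℤ₍ p ₎ w → InS P Q ℤ₍ p ₎ v →
      G*-eq ℤ₍ p ₎ w v → G*-eq ℚ-all w v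
    homomorphism : ∀ w v → InS P Q ℤ₍ p ₎ w → InS P Q ℤ₍ p ₎ v →
      G*-eq ℚ-all (mul P Q w v) (mul P Q w v)
    injective : ∀ w v → InS P Q ℤ₍ p ₎ w → InS P Q ℤ₍ p ₎ v →
      G*-eq ℚ-all w v → G*-eq ℤ₍ p ₎ w v
    surjective : ∀ w → InS P Q ℚ-all w → InK P Q p w →
      Σ Seq λ v → InS P Q ℤ₍ p ₎ v × G*-eq ℚ-all v w

{-# OPTIONS --safe #-}
module Submission where

-- (i) If w₁, w₀ ∈ ℤ₍p₎ and Λ(w₁,w₀) is a ℤ₍p₎-unit, multiply w by a common denominator D with
-- p ∤ D and divide by the gcd g of the resulting integers: the rescaled sequence has coprime
-- integral initial terms (a,b), and g²·Λ(a,b) = D²·Λ(w₁,w₀) is prime to p.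
-- (ii) Conversely, integral initial terms with p ∤ Λ(a,b) give a sequence over ℤ₍p₎, because
-- ℤ₍p₎ contains P and Q⁻¹ (p ∤ Q), so the recurrence can be run in both directions inside it.
-- (iii) If w = c·v(· + ν) with w, v over ℤ₍p₎, then Λ(w₁,w₀) = c²·Q^ν·Λ(v₁,v₀), so c² is a
-- ℤ₍p₎-unit, and hence so is c, ℤ₍p₎ being integrally closed.

open import Defs
open import Data.Nat as ℕ using (ℕ)
import Data.Nat.Properties as ℕP
import Data.Nat.Divisibility as ℕD
open import Data.Nat.DivMod using (m/n*n≡m)
open import Data.Nat.GCD using (gcd; gcd[m,n]∣m; gcd[m,n]∣n; gcd[m,n]≡0⇒m≡0; gcd[m,n]≡0⇒n≡0)
open import Data.Nat.Coprimality using (Coprime; coprime-/gcd; 1-coprimeTo; recompute)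
open import Data.Nat.Primality using (Prime; euclidsLemma; ¬prime[1])
open import Data.Integer as ℤ using (ℤ; +_; -[1+_]; ∣_∣; 0ℤ; 1ℤ; sign; _◃_)
import Data.Integer.Properties as ℤP
import Data.Integer.Divisibility.Signed as Signed
open import Data.Integer.Divisibility using (_∣_)
import Data.Integer.Tactic.RingSolver as ℤ-Solver
open import Data.Rational as ℚ using (ℚ; 0ℚ; 1ℚ; _+_; _*_; _-_; -_; ↥_; ↧_)
import Data.Rational.Properties as ℚP
open import Data.Rational.Unnormalised as ℚᵘ using (mkℚᵘ) renaming (_≃_ to _≃ᵘ_)
import Data.Rational.Unnormalised.Properties as ℚᵘP
import Data.Sign as Sign
import Data.Sign.Properties as SignP
open import Data.Product using (Σ; _×_; _,_; proj₁; proj₂)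
open import Data.Sum as Sum using (_⊎_; [_,_]′)
open import Data.Unit using (tt)
open import Data.Empty using (⊥)
open import Relation.Nullary.Decidable using (dec⇒maybe)
open import Function using (_∘_; flip)
open import Level using (0ℓ)
open import Relation.Nullary using (¬_; yes; no; contradiction)
open import Relation.Binary.PropositionalEquality
open import Tactic.RingSolver using (solve-∀)
import Tactic.RingSolver.Core.AlmostCommutativeRing as ACR

private
  variable
    x y : ℚ
    a b : ℤ

ℚ-ring : ACR.AlmostCommutativeRing 0ℓ 0ℓ
ℚ-ring = ACR.fromCommutativeRing ℚP.+-*-commutativeRing (λ x → dec⇒maybe (0ℚ ℚP.≟ x))

ι-toℚᵘ : ∀ z → ℚ.toℚᵘ (ι z) ≃ᵘ mkℚᵘ z 0
ι-toℚᵘ z = ℚP.toℚᵘ-fromℚᵘ (mkℚᵘ z 0)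

ι-injective : ι a ≡ ι b → a ≡ b
ι-injective {a} {b} eq with ℚᵘP.≃-trans (ℚᵘP.≃-sym (ι-toℚᵘ a)) (ℚᵘP.≃-trans (ℚP.toℚᵘ-cong eq) (ι-toℚᵘ b))
... | ℚᵘ.*≡* a*1≡b*1 = trans (sym (ℤP.*-identityʳ a)) (trans a*1≡b*1 (ℤP.*-identityʳ b))

ι-+ : ∀ a b → ι (a ℤ.+ b) ≡ ι a + ι b
ι-+ a b = ℚP.toℚᵘ-injective (begin
  ℚ.toℚᵘ (ι (a ℤ.+ b))                    ≈⟨ ι-toℚᵘ (a ℤ.+ b) ⟩
  mkℚᵘ (a ℤ.+ b) 0                        ≈⟨ ℚᵘP.≃-reflexive (cong₂ (λ s t → mkℚᵘ (s ℤ.+ t) 0)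
                                                (sym (ℤP.*-identityʳ a)) (sym (ℤP.*-identityʳ b))) ⟩
  mkℚᵘ a 0 ℚᵘ.+ mkℚᵘ b 0                  ≈⟨ ℚᵘP.+-cong (ι-toℚᵘ a) (ι-toℚᵘ b) ⟨
  ℚ.toℚᵘ (ι a) ℚᵘ.+ ℚ.toℚᵘ (ι b)          ≈⟨ ℚP.toℚᵘ-homo-+ (ι a) (ι b) ⟨
  ℚ.toℚᵘ (ι a + ι b)                      ∎)
  where open ℚᵘP.≃-Reasoning

ι-* : ∀ a b → ι (a ℤ.* b) ≡ ι a * ι b
ι-* a b = ℚP.toℚᵘ-injective (begin
  ℚ.toℚᵘ (ι (a ℤ.* b))                    ≈⟨ ι-toℚᵘ (a ℤ.* b) ⟩
  mkℚᵘ a 0 ℚᵘ.* mkℚᵘ b 0                  ≈⟨ ℚᵘP.*-cong (ι-toℚᵘ a) (ι-toℚᵘ b) ⟨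
  ℚ.toℚᵘ (ι a) ℚᵘ.* ℚ.toℚᵘ (ι b)          ≈⟨ ℚP.toℚᵘ-homo-* (ι a) (ι b) ⟨
  ℚ.toℚᵘ (ι a * ι b)                      ∎)
  where open ℚᵘP.≃-Reasoning

ι-neg : ∀ a → ι (ℤ.- a) ≡ - ι a
ι-neg a = ℚP.toℚᵘ-injective (begin
  ℚ.toℚᵘ (ι (ℤ.- a))          ≈⟨ ι-toℚᵘ (ℤ.- a) ⟩
  ℚᵘ.- mkℚᵘ a 0               ≈⟨ ℚᵘP.-‿cong (ι-toℚᵘ a) ⟨
  ℚᵘ.- ℚ.toℚᵘ (ι a)           ≈⟨ ℚP.toℚᵘ-homo‿- (ι a) ⟨
  ℚ.toℚᵘ (- ι a)              ∎)
  where open ℚᵘP.≃-Reasoning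

ι-- : ∀ a b → ι (a ℤ.- b) ≡ ι a - ι b
ι-- a b = trans (ι-+ a (ℤ.- b)) (cong (_+_ (ι a)) (ι-neg b))

ι-Λ : ∀ P Q a b → ι (Λℤ P Q a b) ≡ Λ P Q (ι a) (ι b)
ι-Λ P Q a b = begin
  ι (a ℤ.* a ℤ.- P ℤ.* b ℤ.* a ℤ.+ Q ℤ.* b ℤ.* b)
    ≡⟨ ι-+ (a ℤ.* a ℤ.- P ℤ.* b ℤ.* a) (Q ℤ.* b ℤ.* b) ⟩
  ι (a ℤ.* a ℤ.- P ℤ.* b ℤ.* a) + ι (Q ℤ.* b ℤ.* b)
    ≡⟨ cong₂ _+_ (ι-- (a ℤ.* a) (P ℤ.* b ℤ.* a)) (ι-*³ Q b b) ⟩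
  ι (a ℤ.* a) - ι (P ℤ.* b ℤ.* a) + ι Q * ι b * ι b
    ≡⟨ cong₂ (λ s t → s - t + ι Q * ι b * ι b) (ι-* a a) (ι-*³ P b a) ⟩
  Λ P Q (ι a) (ι b) ∎
  where
  open ≡-Reasoning
  ι-*³ : ∀ a b c → ι (a ℤ.* b ℤ.* c) ≡ ι a * ι b * ι c
  ι-*³ a b c = trans (ι-* (a ℤ.* b) c) (cong (_* ι c) (ι-* a b))

Λℤ-scale : ∀ P Q a b g → Λℤ P Q (a ℤ.* g) (b ℤ.* g) ≡ g ℤ.* g ℤ.* Λℤ P Q a b
Λℤ-scale = scale
  where
  scale : ∀ P Q a b g →
    (a ℤ.* g) ℤ.* (a ℤ.* g) ℤ.- P ℤ.* (b ℤ.* g) ℤ.* (a ℤ.* g) ℤ.+ Q ℤ.* (b ℤ.* g) ℤ.* (b ℤ.* g)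
      ≡ g ℤ.* g ℤ.* (a ℤ.* a ℤ.- P ℤ.* b ℤ.* a ℤ.+ Q ℤ.* b ℤ.* b)
  scale = ℤ-Solver.solve-∀

ι≢0 : a ≢ 0ℤ → ι a ≢ 0ℚ
ι≢0 a≢0 = a≢0 ∘ ι-injective

x*↧x≡↥x : ∀ x → x * ι (↧ x) ≡ ι (↥ x)
x*↧x≡↥x x@(ℚ.mkℚ n d-1 _) = ℚP.toℚᵘ-injective (begin
  ℚ.toℚᵘ (x * ι (↧ x))               ≈⟨ ℚP.toℚᵘ-homo-* x (ι (↧ x)) ⟩
  mkℚᵘ n d-1 ℚᵘ.* ℚ.toℚᵘ (ι (↧ x))   ≈⟨ ℚᵘP.*-congˡ (ι-toℚᵘ (↧ x)) ⟩
  mkℚᵘ n d-1 ℚᵘ.* mkℚᵘ (↧ x) 0       ≈⟨ ℚᵘ.*≡* (ℤP.*-assoc n (↧ x) 1ℤ) ⟩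
  mkℚᵘ n 0                           ≈⟨ ι-toℚᵘ n ⟨
  ℚ.toℚᵘ (ι n)                       ∎)
  where open ℚᵘP.≃-Reasoning

invℚ-inverseˡ : x ≢ 0ℚ → invℚ x * x ≡ 1ℚ
invℚ-inverseˡ {x} x≢0 with x ℚP.≟ 0ℚ
... | yes x≡0 = contradiction x≡0 x≢0
... | no x≢0′ = ℚP.*-inverseˡ x {{ℚ.≢-nonZero x≢0′}}

x-y+z≡0⇒x≡y-z : ∀ x y z → x - y + z ≡ 0ℚ → x ≡ y - z
x-y+z≡0⇒x≡y-z x y z eq = begin
  x                    ≡⟨ split x y z ⟩
  (x - y + z) + (y - z) ≡⟨ cong (_+ (y - z)) eq ⟩
  0ℚ + (y - z)          ≡⟨ ℚP.+-identityˡ (y - z) ⟩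
  y - z                 ∎
  where
  open ≡-Reasoning
  split : ∀ x y z → x ≡ (x - y + z) + (y - z)
  split = solve-∀ ℚ-ring

x-y+z≡0⇒z≡y-x : ∀ x y z → x - y + z ≡ 0ℚ → z ≡ y - x
x-y+z≡0⇒z≡y-x x y z eq = begin
  z                     ≡⟨ split x y z ⟩
  (y - x) + (x - y + z) ≡⟨ cong (_+_ (y - x)) eq ⟩
  (y - x) + 0ℚ          ≡⟨ ℚP.+-identityʳ (y - x) ⟩
  y - x                 ∎
  where
  open ≡-Reasoning
  split : ∀ x y z → z ≡ (y - x) + (x - y + z)
  split = solve-∀ ℚ-ring

y*x≡1⇒z≡y*[x*z] : ∀ y x z → y * x ≡ 1ℚ → z ≡ y * (x * z)
y*x≡1⇒z≡y*[x*z] y x z yx≡1 = begin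
  z           ≡⟨ ℚP.*-identityˡ z ⟨
  1ℚ * z      ≡⟨ cong (_* z) yx≡1 ⟨
  y * x * z   ≡⟨ ℚP.*-assoc y x z ⟩
  y * (x * z) ∎
  where open ≡-Reasoning

record IsSubring (R : SubRing) : Set where
  field
    ι-closed : ∀ a → R (ι a)
    +-closed : ∀ {x y} → R x → R y → R (x + y)
    -‿closed : ∀ {x} → R x → R (- x)
    *-closed : ∀ {x y} → R x → R y → R (x * y)

ℚ-all-isSubring : IsSubring ℚ-all
ℚ-all-isSubring = record
  { ι-closed = λ _ → tt ; +-closed = λ _ _ → tt ; -‿closed = λ _ → tt ; *-closed = λ _ _ → tt }

shift-by-0 : ∀ {w v : Seq} {c} → (∀ n → w n ≡ c * v n) → ∀ n → w n ≡ c * v (n ℤ.+ 0ℤ)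
shift-by-0 {v = v} {c} w≡cv n = trans (w≡cv n) (cong (λ m → c * v m) (sym (ℤP.+-identityʳ n)))

module _ {R : SubRing} where

  IsUnit-inverse : (u : IsUnit R x) → IsUnit R (proj₁ u)
  IsUnit-inverse {x} (y , x∈R , y∈R , xy≡1) = x , y∈R , x∈R , trans (ℚP.*-comm y x) xy≡1

  IsUnit-* : IsSubring R → ∀ x y → IsUnit R x → IsUnit R y → IsUnit R (x * y)
  IsUnit-* R-sub x y (x′ , x∈R , x′∈R , xx′≡1) (y′ , y∈R , y′∈R , yy′≡1) =
    x′ * y′ , *-closed x∈R y∈R , *-closed x′∈R y′∈R , (begin
      (x * y) * (x′ * y′) ≡⟨ shuffle x y x′ y′ ⟩
      (x * x′) * (y * y′) ≡⟨ cong₂ _*_ xx′≡1 yy′≡1 ⟩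
      1ℚ                  ∎)
    where
    open IsSubring R-sub
    open ≡-Reasoning
    shuffle : ∀ x y x′ y′ → (x * y) * (x′ * y′) ≡ (x * x′) * (y * y′)
    shuffle = solve-∀ ℚ-ring

  IsUnit⇒IsUnit-ℚ : IsUnit R x → IsUnit ℚ-all x
  IsUnit⇒IsUnit-ℚ (y , _ , _ , xy≡1) = y , tt , tt , xy≡1

  G-eq⇒G-eq-ℚ : ∀ {w v} → G-eq R w v → G-eq ℚ-all w v
  G-eq⇒G-eq-ℚ (c , c-unit , w≡cv) = c , IsUnit⇒IsUnit-ℚ c-unit , w≡cv

  G*-eq⇒G*-eq-ℚ : ∀ {w v} → G*-eq R w v → G*-eq ℚ-all w v
  G*-eq⇒G*-eq-ℚ (c , c-unit , ν , w≡cv) = c , IsUnit⇒IsUnit-ℚ c-unit , ν , w≡cv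

  G-eq-sym : ∀ {w v} → G-eq R w v → G-eq R v w
  G-eq-sym {w} {v} (c , c-unit@(c′ , _ , _ , cc′≡1) , w≡cv) =
    c′ , IsUnit-inverse c-unit , λ n →
      trans (y*x≡1⇒z≡y*[x*z] c′ c (v n) (trans (ℚP.*-comm c′ c) cc′≡1)) (cong (c′ *_) (sym (w≡cv n)))

  G-eq⇒G*-eq : ∀ {w v} → G-eq R w v → G*-eq R w v
  G-eq⇒G*-eq {w} {v} (c , c-unit , w≡cv) = c , c-unit , 0ℤ , shift-by-0 {w} {v} {c} w≡cv

IsUnit-ℚ-ι : a ≢ 0ℤ → IsUnit ℚ-all (ι a)
IsUnit-ℚ-ι {a} a≢0 =
  invℚ (ι a) , tt , tt , trans (ℚP.*-comm (ι a) (invℚ (ι a))) (invℚ-inverseˡ (ι≢0 a≢0))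

G-eq-ℚ-refl : ∀ w → G-eq ℚ-all w w
G-eq-ℚ-refl w = 1ℚ , (1ℚ , tt , tt , ℚP.*-identityˡ 1ℚ) , λ n → sym (ℚP.*-identityˡ (w n))

∣i∣≡q*g⇒i≡[sign[i]◃q]*g : ∀ i q g → ∣ i ∣ ≡ q ℕ.* g → i ≡ (sign i ◃ q) ℤ.* + g
∣i∣≡q*g⇒i≡[sign[i]◃q]*g i q g ∣i∣≡q*g = begin
  i                                ≡⟨ ℤP.◃-inverse i ⟨
  sign i ◃ ∣ i ∣                    ≡⟨ cong₂ _◃_ (sym (SignP.*-identityʳ (sign i))) ∣i∣≡q*g ⟩
  (sign i Sign.* Sign.+) ◃ (q ℕ.* g) ≡⟨ ℤP.◃-distrib-* (sign i) Sign.+ q g ⟩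
  (sign i ◃ q) ℤ.* (Sign.+ ◃ g)     ≡⟨ cong ((sign i ◃ q) ℤ.*_) (ℤP.+◃n≡+n g) ⟩
  (sign i ◃ q) ℤ.* + g              ∎
  where open ≡-Reasoning

coprime-factorisation : ∀ m n → Σ ℤ λ g → Σ ℤ λ a → Σ ℤ λ b →
  m ≡ a ℤ.* g × n ≡ b ℤ.* g × Coprime ∣ a ∣ ∣ b ∣
coprime-factorisation m n with gcd ∣ m ∣ ∣ n ∣ ℕ.≟ 0
... | yes g≡0 = 0ℤ , 1ℤ , 0ℤ , ℤP.∣i∣≡0⇒i≡0 (gcd[m,n]≡0⇒m≡0 g≡0) ,
  ℤP.∣i∣≡0⇒i≡0 (gcd[m,n]≡0⇒n≡0 ∣ m ∣ g≡0) , 1-coprimeTo 0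
... | no g≢0 = + g , sign m ◃ (∣ m ∣ ℕ./ g) , sign n ◃ (∣ n ∣ ℕ./ g) ,
  ∣i∣≡q*g⇒i≡[sign[i]◃q]*g m (∣ m ∣ ℕ./ g) g (sym (m/n*n≡m (gcd[m,n]∣m ∣ m ∣ ∣ n ∣))) ,
  ∣i∣≡q*g⇒i≡[sign[i]◃q]*g n (∣ n ∣ ℕ./ g) g (sym (m/n*n≡m (gcd[m,n]∣n ∣ m ∣ ∣ n ∣))) ,
  subst₂ Coprime (sym (ℤP.abs-◃ (sign m) _)) (sym (ℤP.abs-◃ (sign n) _)) (coprime-/gcd ∣ m ∣ ∣ n ∣)
  where
  g = gcd ∣ m ∣ ∣ n ∣
  instance
    g-nonZero : ℕ.NonZero g
    g-nonZero = ℕ.≢-nonZero g≢0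

ℤ-bi-induction : (C : ℤ → Set) → C 0ℤ → (∀ n → C n → C (n ℤ.+ 1ℤ)) → (∀ n → C (n ℤ.+ 1ℤ) → C n) →
  ∀ n → C n
ℤ-bi-induction C c₀ up down (+ ℕ.zero)    = c₀
ℤ-bi-induction C c₀ up down (+ ℕ.suc k)   =
  subst (C ∘ +_) (ℕP.+-comm k 1) (up (+ k) (ℤ-bi-induction C c₀ up down (+ k)))
ℤ-bi-induction C c₀ up down -[1+ ℕ.zero ]  = down -[1+ 0 ] c₀
ℤ-bi-induction C c₀ up down -[1+ ℕ.suc k ] = down -[1+ ℕ.suc k ] (ℤ-bi-induction C c₀ up down -[1+ k ])

cross-multiply : ∀ x a d b e → x * ι d ≡ ι a → x * ι e ≡ ι b → b ℤ.* d ≡ a ℤ.* e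
cross-multiply x a d b e xd≡a xe≡b = ι-injective (begin
  ι (b ℤ.* d)    ≡⟨ ι-* b d ⟩
  ι b * ι d      ≡⟨ cong (_* ι d) xe≡b ⟨
  x * ι e * ι d  ≡⟨ swap x (ι e) (ι d) ⟩
  x * ι d * ι e  ≡⟨ cong (_* ι e) xd≡a ⟩
  ι a * ι e      ≡⟨ ι-* a e ⟨
  ι (a ℤ.* e)    ∎)
  where
  open ≡-Reasoning
  swap : ∀ x y z → x * y * z ≡ x * z * y
  swap = solve-∀ ℚ-ring

clear-by : ∀ x a d → x * ι d ≡ ι a → ∀ e → x * ι (d ℤ.* e) ≡ ι (a ℤ.* e)
clear-by x a d xd≡a e = begin
  x * ι (d ℤ.* e)   ≡⟨ cong (x *_) (ι-* d e) ⟩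
  x * (ι d * ι e)   ≡⟨ ℚP.*-assoc x (ι d) (ι e) ⟨
  x * ι d * ι e     ≡⟨ cong (_* ι e) xd≡a ⟩
  ι a * ι e         ≡⟨ ι-* a e ⟨
  ι (a ℤ.* e)       ∎
  where open ≡-Reasoning

clear-* : ∀ x a d y b e → x * ι d ≡ ι a → y * ι e ≡ ι b → (x * y) * ι (d ℤ.* e) ≡ ι (a ℤ.* b)
clear-* x a d y b e xd≡a ye≡b = begin
  (x * y) * ι (d ℤ.* e)     ≡⟨ cong ((x * y) *_) (ι-* d e) ⟩
  (x * y) * (ι d * ι e)     ≡⟨ shuffle x y (ι d) (ι e) ⟩
  (x * ι d) * (y * ι e)     ≡⟨ cong₂ _*_ xd≡a ye≡b ⟩
  ι a * ι b                 ≡⟨ ι-* a b ⟨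
  ι (a ℤ.* b)               ∎
  where
  open ≡-Reasoning
  shuffle : ∀ x y u v → (x * y) * (u * v) ≡ (x * u) * (y * v)
  shuffle = solve-∀ ℚ-ring

clear-+ : ∀ x a d y b e → x * ι d ≡ ι a → y * ι e ≡ ι b → (x + y) * ι (d ℤ.* e) ≡ ι (a ℤ.* e ℤ.+ b ℤ.* d)
clear-+ x a d y b e xd≡a ye≡b = begin
  (x + y) * ι (d ℤ.* e)               ≡⟨ cong ((x + y) *_) (ι-* d e) ⟩
  (x + y) * (ι d * ι e)               ≡⟨ expand x y (ι d) (ι e) ⟩
  (x * ι d) * ι e + (y * ι e) * ι d   ≡⟨ cong₂ (λ s t → s * ι e + t * ι d) xd≡a ye≡b ⟩
  ι a * ι e + ι b * ι d               ≡⟨ cong₂ _+_ (ι-* a e) (ι-* b d) ⟨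
  ι (a ℤ.* e) + ι (b ℤ.* d)           ≡⟨ ι-+ (a ℤ.* e) (b ℤ.* d) ⟨
  ι (a ℤ.* e ℤ.+ b ℤ.* d)             ∎
  where
  open ≡-Reasoning
  expand : ∀ x y u v → (x + y) * (u * v) ≡ (x * u) * v + (y * v) * u
  expand = solve-∀ ℚ-ring

clear-neg : ∀ x a d → x * ι d ≡ ι a → (- x) * ι d ≡ ι (ℤ.- a)
clear-neg x a d xd≡a = begin
  (- x) * ι d     ≡⟨ ℚP.neg-distribˡ-* x (ι d) ⟨
  - (x * ι d)     ≡⟨ cong -_ xd≡a ⟩
  - ι a           ≡⟨ ι-neg a ⟨
  ι (ℤ.- a)       ∎
  where open ≡-Reasoning

module Recurrence (P Q : ℤ) where

  Recurrent : Seq → Set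
  Recurrent w = ∀ n → w (n ℤ.+ + 2) - ι P * w (n ℤ.+ + 1) + ι Q * w n ≡ 0ℚ

  Λ-at : Seq → ℤ → ℚ
  Λ-at w n = Λ P Q (w (n ℤ.+ 1ℤ)) (w n)

  Λ-scale : ∀ c a b → Λ P Q (c * a) (c * b) ≡ c * c * Λ P Q a b
  Λ-scale = scale (ι P) (ι Q)
    where
    scale : ∀ p q c a b → (c * a) * (c * a) - p * (c * b) * (c * a) + q * (c * b) * (c * b)
                          ≡ c * c * (a * a - p * b * a + q * b * b)
    scale = solve-∀ ℚ-ring

  Recurrent-scale : ∀ {w} → Recurrent w → ∀ k → Recurrent (λ n → k * w n)
  Recurrent-scale {w} rec k n = begin
    k * w (n ℤ.+ + 2) - ι P * (k * w (n ℤ.+ 1ℤ)) + ι Q * (k * w n)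
      ≡⟨ factor k (w (n ℤ.+ + 2)) (w (n ℤ.+ 1ℤ)) (w n) (ι P) (ι Q) ⟩
    k * (w (n ℤ.+ + 2) - ι P * w (n ℤ.+ 1ℤ) + ι Q * w n)
      ≡⟨ cong (k *_) (rec n) ⟩
    k * 0ℚ
      ≡⟨ ℚP.*-zeroʳ k ⟩
    0ℚ ∎
    where
    open ≡-Reasoning
    factor : ∀ k x y z p q → k * x - p * (k * y) + q * (k * z) ≡ k * (x - p * y + q * z)
    factor = solve-∀ ℚ-ring

  module _ {w : Seq} (rec : Recurrent w) where

    forward : ∀ n → w ((n ℤ.+ 1ℤ) ℤ.+ 1ℤ) ≡ ι P * w (n ℤ.+ 1ℤ) - ι Q * w n
    forward n = trans (cong w (ℤP.+-assoc n 1ℤ 1ℤ))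
      (x-y+z≡0⇒x≡y-z (w (n ℤ.+ + 2)) (ι P * w (n ℤ.+ 1ℤ)) (ι Q * w n) (rec n))

    backward : ∀ n → ι Q * w n ≡ ι P * w (n ℤ.+ 1ℤ) - w ((n ℤ.+ 1ℤ) ℤ.+ 1ℤ)
    backward n = trans (x-y+z≡0⇒z≡y-x (w (n ℤ.+ + 2)) (ι P * w (n ℤ.+ 1ℤ)) (ι Q * w n) (rec n))
      (cong (λ m → ι P * w (n ℤ.+ 1ℤ) - w m) (sym (ℤP.+-assoc n 1ℤ 1ℤ)))

    Λ-at-suc : ∀ n → Λ-at w (n ℤ.+ 1ℤ) ≡ ι Q * Λ-at w n
    Λ-at-suc n = trans (cong (λ t → Λ P Q t (w (n ℤ.+ 1ℤ))) (forward n))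
      (shift (ι P) (ι Q) (w n) (w (n ℤ.+ 1ℤ)))
      where
      shift : ∀ p q x y → (p * y - q * x) * (p * y - q * x) - p * y * (p * y - q * x) + q * y * y
                          ≡ q * (y * y - p * x * y + q * x * x)
      shift = solve-∀ ℚ-ring

    module _ {R : SubRing} (R-sub : IsSubring R) (Q-unit : IsUnit R (ι Q)) where
      open IsSubring R-sub

      private
        Q⁻¹ : ℚ
        Q⁻¹ = proj₁ Q-unit

        Q⁻¹∈R : R Q⁻¹
        Q⁻¹∈R = proj₁ (proj₂ (proj₂ Q-unit))

        divide-by-Q : ∀ x → x ≡ Q⁻¹ * (ι Q * x)
        divide-by-Q x =
          y*x≡1⇒z≡y*[x*z] Q⁻¹ (ι Q) x (trans (ℚP.*-comm Q⁻¹ (ι Q)) (proj₂ (proj₂ (proj₂ Q-unit))))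

      Recurrent-closed : R (w 0ℤ) → R (w 1ℤ) → ∀ n → R (w n)
      Recurrent-closed r₀ r₁ n =
        proj₁ (ℤ-bi-induction (λ n → R (w n) × R (w (n ℤ.+ 1ℤ))) (r₀ , r₁) up down n)
        where
        up : ∀ n → R (w n) × R (w (n ℤ.+ 1ℤ)) → R (w (n ℤ.+ 1ℤ)) × R (w ((n ℤ.+ 1ℤ) ℤ.+ 1ℤ))
        up n (rₙ , rₙ₊₁) =
          rₙ₊₁ , subst R (sym (forward n))
            (+-closed (*-closed (ι-closed P) rₙ₊₁) (-‿closed (*-closed (ι-closed Q) rₙ)))
        down : ∀ n → R (w (n ℤ.+ 1ℤ)) × R (w ((n ℤ.+ 1ℤ) ℤ.+ 1ℤ)) → R (w n) × R (w (n ℤ.+ 1ℤ))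
        down n (rₙ₊₁ , rₙ₊₂) =
          subst R (sym (trans (divide-by-Q (w n)) (cong (Q⁻¹ *_) (backward n))))
            (*-closed Q⁻¹∈R (+-closed (*-closed (ι-closed P) rₙ₊₁) (-‿closed rₙ₊₂))) , rₙ₊₁

      Λ-at-IsUnit : IsUnit R (Λ-at w 0ℤ) → ∀ n → IsUnit R (Λ-at w n)
      Λ-at-IsUnit u₀ = ℤ-bi-induction (IsUnit R ∘ Λ-at w) u₀ up down
        where
        up : ∀ n → IsUnit R (Λ-at w n) → IsUnit R (Λ-at w (n ℤ.+ 1ℤ))
        up n u = subst (IsUnit R) (sym (Λ-at-suc n)) (IsUnit-* R-sub (ι Q) (Λ-at w n) Q-unit u)
        down : ∀ n → IsUnit R (Λ-at w (n ℤ.+ 1ℤ)) → IsUnit R (Λ-at w n)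
        down n u = subst (IsUnit R)
          (sym (trans (divide-by-Q (Λ-at w n)) (cong (Q⁻¹ *_) (sym (Λ-at-suc n)))))
          (IsUnit-* R-sub Q⁻¹ (Λ-at w (n ℤ.+ 1ℤ)) (IsUnit-inverse Q-unit) u)

module Localisation (p : ℕ) (p-prime : Prime p) where

  -- Signed divisibility is a record, so unlike the unsigned _∣_ of Defs it lets Agda infer the
  -- dividend.
  infix 4 p∣_
  p∣_ : ℤ → Set
  p∣ a = + p Signed.∣ a

  ¬p∣⇒¬p∣ᵤ : ¬ p∣ a → ¬ (+ p ∣ a)
  ¬p∣⇒¬p∣ᵤ p∤a = p∤a ∘ Signed.∣ᵤ⇒∣

  ¬p∣ᵤ⇒¬p∣ : ¬ (+ p ∣ a) → ¬ p∣ a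
  ¬p∣ᵤ⇒¬p∣ p∤a = p∤a ∘ Signed.∣⇒∣ᵤ

  p≢1 : p ≢ 1
  p≢1 refl = ¬prime[1] p-prime

  p∣0 : p∣ 0ℤ
  p∣0 = Signed.divides 0ℤ refl

  ¬p∣1 : ¬ p∣ 1ℤ
  ¬p∣1 = p≢1 ∘ ℕD.∣1⇒≡1 ∘ Signed.∣⇒∣ᵤ

  ¬p∣⇒≢0 : ¬ p∣ a → a ≢ 0ℤ
  ¬p∣⇒≢0 p∤a refl = p∤a p∣0

  p∣-euclid : ∀ a b → p∣ a ℤ.* b → p∣ a ⊎ p∣ b
  p∣-euclid a b p∣ab = Sum.map Signed.∣ᵤ⇒∣ Signed.∣ᵤ⇒∣
    (euclidsLemma ∣ a ∣ ∣ b ∣ p-prime (subst (p ℕD.∣_) (ℤP.abs-* a b) (Signed.∣⇒∣ᵤ p∣ab)))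

  ¬p∣-* : ¬ p∣ a → ¬ p∣ b → ¬ p∣ a ℤ.* b
  ¬p∣-* {a} {b} p∤a p∤b p∣ab = [ p∤a , p∤b ]′ (p∣-euclid a b p∣ab)

  ¬p∣↥∧p∣↧ : ∀ x → p∣ ↥ x → p∣ ↧ x → ⊥
  ¬p∣↥∧p∣↧ (ℚ.mkℚ _ _ coprime) p∣↥x p∣↧x = p≢1 (recompute coprime (Signed.∣⇒∣ᵤ p∣↥x , Signed.∣⇒∣ᵤ p∣↧x))

  -- Not necessarily in lowest terms: unlike the reduced denominator defining ℤ₍ p ₎, such
  -- representations are closed under the ring operations.
  record Fraction (x : ℚ) : Set where
    constructor fraction
    field
      num den : ℤ
      ¬p∣den : ¬ p∣ den
      x*den≡num : x * ι den ≡ ι num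

  ℤ₍p₎⇒Fraction : ∀ x → ℤ₍ p ₎ x → Fraction x
  ℤ₍p₎⇒Fraction x x∈ℤ₍p₎ = fraction (↥ x) (↧ x) (¬p∣ᵤ⇒¬p∣ x∈ℤ₍p₎) (x*↧x≡↥x x)

  Fraction⇒ℤ₍p₎ : Fraction x → ℤ₍ p ₎ x
  Fraction⇒ℤ₍p₎ {x} (fraction a d p∤d xd≡a) p∣↧x =
    [ flip (¬p∣↥∧p∣↧ x) p∣↧x′ , p∤d ]′ (p∣-euclid (↥ x) d p∣↥x*d)
    where
    p∣↧x′ : p∣ ↧ x
    p∣↧x′ = Signed.∣ᵤ⇒∣ p∣↧x
    p∣↥x*d : p∣ ↥ x ℤ.* d
    p∣↥x*d = subst p∣_ (cross-multiply x (↥ x) (↧ x) a d (x*↧x≡↥x x) xd≡a) (Signed.∣n⇒∣m*n a p∣↧x′)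

  ℤ₍p₎-isSubring : IsSubring ℤ₍ p ₎
  ℤ₍p₎-isSubring = record
    { ι-closed = λ a → Fraction⇒ℤ₍p₎ {ι a} (fraction a 1ℤ ¬p∣1 (ℚP.*-identityʳ (ι a)))
    ; +-closed = λ {x} {y} x∈ y∈ → Fraction⇒ℤ₍p₎ (+-fraction (ℤ₍p₎⇒Fraction x x∈) (ℤ₍p₎⇒Fraction y y∈))
    ; -‿closed = λ {x} x∈ → Fraction⇒ℤ₍p₎ (neg-fraction (ℤ₍p₎⇒Fraction x x∈))
    ; *-closed = λ {x} {y} x∈ y∈ → Fraction⇒ℤ₍p₎ (*-fraction (ℤ₍p₎⇒Fraction x x∈) (ℤ₍p₎⇒Fraction y y∈))
    }
    where
    +-fraction : Fraction x → Fraction y → Fraction (x + y)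
    +-fraction {x} {y} (fraction a d p∤d xd≡a) (fraction b e p∤e ye≡b) =
      fraction (a ℤ.* e ℤ.+ b ℤ.* d) (d ℤ.* e) (¬p∣-* p∤d p∤e) (clear-+ x a d y b e xd≡a ye≡b)
    neg-fraction : Fraction x → Fraction (- x)
    neg-fraction {x} (fraction a d p∤d xd≡a) = fraction (ℤ.- a) d p∤d (clear-neg x a d xd≡a)
    *-fraction : Fraction x → Fraction y → Fraction (x * y)
    *-fraction {x} {y} (fraction a d p∤d xd≡a) (fraction b e p∤e ye≡b) =
      fraction (a ℤ.* b) (d ℤ.* e) (¬p∣-* p∤d p∤e) (clear-* x a d y b e xd≡a ye≡b)

  -- ↥x² · den ≡ num · ↧x², so p ∣ ↧x would force p ∣ ↥x or p ∣ den.
  ℤ₍p₎-sqrt : ∀ x → ℤ₍ p ₎ (x * x) → ℤ₍ p ₎ x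
  ℤ₍p₎-sqrt x x²∈ℤ₍p₎ p∣↧x =
    [ [ p∤↥x , p∤↥x ]′ ∘ p∣-euclid (↥ x) (↥ x) , ¬p∣den ]′ (p∣-euclid (↥ x ℤ.* ↥ x) den p∣↥x²*den)
    where
    open Fraction (ℤ₍p₎⇒Fraction (x * x) x²∈ℤ₍p₎)
    p∣↧x′ : p∣ ↧ x
    p∣↧x′ = Signed.∣ᵤ⇒∣ p∣↧x
    p∤↥x : ¬ p∣ ↥ x
    p∤↥x p∣↥x = ¬p∣↥∧p∣↧ x p∣↥x p∣↧x′
    num*↧x²≡↥x²*den : num ℤ.* (↧ x ℤ.* ↧ x) ≡ (↥ x ℤ.* ↥ x) ℤ.* den
    num*↧x²≡↥x²*den = cross-multiply (x * x) (↥ x ℤ.* ↥ x) (↧ x ℤ.* ↧ x) num den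
      (clear-* x (↥ x) (↧ x) x (↥ x) (↧ x) (x*↧x≡↥x x) (x*↧x≡↥x x)) x*den≡num
    p∣↥x²*den : p∣ (↥ x ℤ.* ↥ x) ℤ.* den
    p∣↥x²*den = subst p∣_ num*↧x²≡↥x²*den (Signed.∣n⇒∣m*n num (Signed.∣m⇒∣m*n (↧ x) p∣↧x′))

  IsUnit-sqrt : IsUnit ℤ₍ p ₎ (x * x) → IsUnit ℤ₍ p ₎ x
  IsUnit-sqrt {x} (y , x²∈ℤ₍p₎ , y∈ℤ₍p₎ , x²y≡1) =
    x * y , ℤ₍p₎-sqrt x x²∈ℤ₍p₎ , ℤ₍p₎-sqrt (x * y) (subst ℤ₍ p ₎ (sym [xy]²≡y) y∈ℤ₍p₎) ,
    trans (sym (ℚP.*-assoc x x y)) x²y≡1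
    where
    [xy]²≡y : (x * y) * (x * y) ≡ y
    [xy]²≡y = begin
      (x * y) * (x * y)  ≡⟨ regroup x y ⟩
      (x * x * y) * y    ≡⟨ cong (_* y) x²y≡1 ⟩
      1ℚ * y             ≡⟨ ℚP.*-identityˡ y ⟩
      y                  ∎
      where
      open ≡-Reasoning
      regroup : ∀ x y → (x * y) * (x * y) ≡ (x * x * y) * y
      regroup = solve-∀ ℚ-ring

  ¬p∣⇒IsUnit-ι : ¬ p∣ a → IsUnit ℤ₍ p ₎ (ι a)
  ¬p∣⇒IsUnit-ι {a} p∤a =
    invℚ (ι a) , ι-closed a , Fraction⇒ℤ₍p₎ {invℚ (ι a)} (fraction 1ℤ a p∤a a⁻¹a≡1) ,
    trans (ℚP.*-comm (ι a) (invℚ (ι a))) a⁻¹a≡1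
    where
    open IsSubring ℤ₍p₎-isSubring
    a⁻¹a≡1 : invℚ (ι a) * ι a ≡ 1ℚ
    a⁻¹a≡1 = invℚ-inverseˡ (ι≢0 (¬p∣⇒≢0 p∤a))

  IsUnit-ι⇒¬p∣ : IsUnit ℤ₍ p ₎ (ι a) → ¬ p∣ a
  IsUnit-ι⇒¬p∣ {a} (y , _ , y∈ℤ₍p₎ , ay≡1) p∣a = ¬p∣den (subst p∣_ num*a≡den (Signed.∣n⇒∣m*n num p∣a))
    where
    open Fraction (ℤ₍p₎⇒Fraction y y∈ℤ₍p₎)
    num*a≡den : num ℤ.* a ≡ den
    num*a≡den = trans (cross-multiply y 1ℤ a num den (trans (ℚP.*-comm y (ι a)) ay≡1) x*den≡num)
      (ℤP.*-identityˡ den)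

module Isomorphism (P Q : ℤ) (p : ℕ) (p-prime : Prime p) (p∤Q : ¬ (+ p ∣ Q)) where
  open Recurrence P Q
  open Localisation p p-prime

  Q-unit : IsUnit ℤ₍ p ₎ (ι Q)
  Q-unit = ¬p∣⇒IsUnit-ι (¬p∣ᵤ⇒¬p∣ {Q} p∤Q)

  InK-of-coprime-multiple : ∀ {w} k a b → Recurrent w → IsUnit ℚ-all k →
    w (+ 1) * k ≡ ι a → w (+ 0) * k ≡ ι b → Coprime ∣ a ∣ ∣ b ∣ → ¬ p∣ Λℤ P Q a b → InK P Q p w
  InK-of-coprime-multiple {w} k a b rec k-unit w₁k≡a w₀k≡b coprime p∤Λ =
    v , ((λ _ → tt) , Recurrent-scale rec k , Λv-unit) , G-eq-sym (k , k-unit , λ _ → refl) ,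
    a , b , v₁≡a , v₀≡b , coprime , ¬p∣⇒¬p∣ᵤ p∤Λ
    where
    v : Seq
    v n = k * w n
    v₁≡a : v (+ 1) ≡ ι a
    v₁≡a = trans (ℚP.*-comm k (w (+ 1))) w₁k≡a
    v₀≡b : v (+ 0) ≡ ι b
    v₀≡b = trans (ℚP.*-comm k (w (+ 0))) w₀k≡b
    Λv-unit : IsUnit ℚ-all (Λ P Q (v (+ 1)) (v (+ 0)))
    Λv-unit = subst (IsUnit ℚ-all) (trans (ι-Λ P Q a b) (sym (cong₂ (Λ P Q) v₁≡a v₀≡b)))
      (IsUnit-ℚ-ι (¬p∣⇒≢0 p∤Λ))

  InK-of-integral-multiple : ∀ {w} k a′ b′ → Recurrent w → IsUnit ℚ-all k →
    w (+ 1) * k ≡ ι a′ → w (+ 0) * k ≡ ι b′ → ¬ p∣ Λℤ P Q a′ b′ → InK P Q p w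
  InK-of-integral-multiple {w} k a′ b′ rec k-unit w₁k≡a′ w₀k≡b′ p∤Λ′ with coprime-factorisation a′ b′
  ... | g , a , b , a′≡ag , b′≡bg , coprime =
    InK-of-coprime-multiple (k * g⁻¹) a b rec
      (IsUnit-* ℚ-all-isSubring k g⁻¹ k-unit (IsUnit-inverse {x = ι g} g-unit))
      (divide (w (+ 1)) a′ a w₁k≡a′ a′≡ag) (divide (w (+ 0)) b′ b w₀k≡b′ b′≡bg) coprime p∤Λ
    where
    p∣Λ′ : p∣ g ℤ.* g ℤ.* Λℤ P Q a b → p∣ Λℤ P Q a′ b′
    p∣Λ′ = subst p∣_ (sym (trans (cong₂ (Λℤ P Q) a′≡ag b′≡bg) (Λℤ-scale P Q a b g)))
    p∤Λ : ¬ p∣ Λℤ P Q a b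
    p∤Λ = p∤Λ′ ∘ p∣Λ′ ∘ Signed.∣n⇒∣m*n (g ℤ.* g)
    g≢0 : g ≢ 0ℤ
    g≢0 g≡0 = p∤Λ′ (p∣Λ′ (Signed.∣m⇒∣m*n (Λℤ P Q a b) (Signed.∣m⇒∣m*n g (subst p∣_ (sym g≡0) p∣0))))
    g-unit : IsUnit ℚ-all (ι g)
    g-unit = IsUnit-ℚ-ι g≢0
    g⁻¹ : ℚ
    g⁻¹ = proj₁ g-unit
    divide : ∀ x c′ c → x * k ≡ ι c′ → c′ ≡ c ℤ.* g → x * (k * g⁻¹) ≡ ι c
    divide x c′ c xk≡c′ c′≡cg = begin
      x * (k * g⁻¹)         ≡⟨ ℚP.*-assoc x k g⁻¹ ⟨
      x * k * g⁻¹           ≡⟨ cong (_* g⁻¹) (trans xk≡c′ (trans (cong ι c′≡cg) (ι-* c g))) ⟩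
      ι c * ι g * g⁻¹       ≡⟨ ℚP.*-assoc (ι c) (ι g) g⁻¹ ⟩
      ι c * (ι g * g⁻¹)     ≡⟨ cong (ι c *_) (proj₂ (proj₂ (proj₂ g-unit))) ⟩
      ι c * 1ℚ              ≡⟨ ℚP.*-identityʳ (ι c) ⟩
      ι c                   ∎
      where open ≡-Reasoning

  InS-ℤ₍p₎⇒InK : ∀ w → InS P Q ℤ₍ p ₎ w → InK P Q p w
  InS-ℤ₍p₎⇒InK w (w∈ℤ₍p₎ , rec , Λw-unit) =
    InK-of-integral-multiple (ι D) a′ b′ rec (IsUnit-ℚ-ι (¬p∣⇒≢0 p∤D)) w₁D≡a′ w₀D≡b′ p∤Λ′
    where
    open Fraction (ℤ₍p₎⇒Fraction (w (+ 1)) (w∈ℤ₍p₎ (+ 1)))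
      renaming (num to a₁; den to d₁; ¬p∣den to p∤d₁; x*den≡num to w₁d₁≡a₁)
    open Fraction (ℤ₍p₎⇒Fraction (w (+ 0)) (w∈ℤ₍p₎ (+ 0)))
      renaming (num to a₀; den to d₀; ¬p∣den to p∤d₀; x*den≡num to w₀d₀≡a₀)
    D a′ b′ : ℤ
    D = d₁ ℤ.* d₀
    a′ = a₁ ℤ.* d₀
    b′ = a₀ ℤ.* d₁
    p∤D : ¬ p∣ D
    p∤D = ¬p∣-* p∤d₁ p∤d₀
    w₁D≡a′ : w (+ 1) * ι D ≡ ι a′
    w₁D≡a′ = clear-by (w (+ 1)) a₁ d₁ w₁d₁≡a₁ d₀
    w₀D≡b′ : w (+ 0) * ι D ≡ ι b′
    w₀D≡b′ = trans (cong (λ t → w (+ 0) * ι t) (ℤP.*-comm d₁ d₀)) (clear-by (w (+ 0)) a₀ d₀ w₀d₀≡a₀ d₁)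
    Λw : ℚ
    Λw = Λ-at w 0ℤ
    Λw*D²≡Λ′ : Λw * ι (D ℤ.* D) ≡ ι (Λℤ P Q a′ b′)
    Λw*D²≡Λ′ = begin
      Λw * ι (D ℤ.* D)                        ≡⟨ cong (Λw *_) (ι-* D D) ⟩
      Λw * (ι D * ι D)                        ≡⟨ ℚP.*-comm Λw (ι D * ι D) ⟩
      ι D * ι D * Λw                          ≡⟨ Λ-scale (ι D) (w (+ 1)) (w (+ 0)) ⟨
      Λ P Q (ι D * w (+ 1)) (ι D * w (+ 0))   ≡⟨ cong₂ (Λ P Q) (trans (ℚP.*-comm (ι D) _) w₁D≡a′)
                                                               (trans (ℚP.*-comm (ι D) _) w₀D≡b′) ⟩
      Λ P Q (ι a′) (ι b′)                     ≡⟨ ι-Λ P Q a′ b′ ⟨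
      ι (Λℤ P Q a′ b′)                        ∎
      where open ≡-Reasoning
    p∤Λ′ : ¬ p∣ Λℤ P Q a′ b′
    p∤Λ′ = IsUnit-ι⇒¬p∣ (subst (IsUnit ℤ₍ p ₎) Λw*D²≡Λ′
      (IsUnit-* ℤ₍p₎-isSubring Λw (ι (D ℤ.* D)) Λw-unit (¬p∣⇒IsUnit-ι (¬p∣-* p∤D p∤D))))

  InS-ℤ₍p₎-of-integral : ∀ {v} a b → Recurrent v → v (+ 1) ≡ ι a → v (+ 0) ≡ ι b →
    ¬ p∣ Λℤ P Q a b → InS P Q ℤ₍ p ₎ v
  InS-ℤ₍p₎-of-integral {v} a b rec v₁≡a v₀≡b p∤Λ =
    Recurrent-closed {v} rec ℤ₍p₎-isSubring Q-unit
      (subst ℤ₍ p ₎ (sym v₀≡b) (ι-closed b)) (subst ℤ₍ p ₎ (sym v₁≡a) (ι-closed a)) ,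
    rec ,
    subst (IsUnit ℤ₍ p ₎) (trans (ι-Λ P Q a b) (sym (cong₂ (Λ P Q) v₁≡a v₀≡b))) (¬p∣⇒IsUnit-ι p∤Λ)
    where open IsSubring ℤ₍p₎-isSubring

  scale-IsUnit : ∀ {w v} c ν → InS P Q ℤ₍ p ₎ w → InS P Q ℤ₍ p ₎ v →
    (∀ n → w n ≡ c * v (n ℤ.+ ν)) → IsUnit ℤ₍ p ₎ c
  scale-IsUnit {w} {v} c ν (_ , _ , Λw-unit) (_ , rec-v , Λv-unit) w≡cv =
    IsUnit-sqrt {c} (subst (IsUnit ℤ₍ p ₎) Λw*Λvν⁻¹≡c²
      (IsUnit-* ℤ₍p₎-isSubring (Λ-at w 0ℤ) Λvν⁻¹ Λw-unit (IsUnit-inverse {x = Λvν} Λvν-unit)))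
    where
    Λvν : ℚ
    Λvν = Λ-at v ν
    Λvν-unit : IsUnit ℤ₍ p ₎ Λvν
    Λvν-unit = Λ-at-IsUnit {v} rec-v ℤ₍p₎-isSubring Q-unit Λv-unit ν
    Λvν⁻¹ : ℚ
    Λvν⁻¹ = proj₁ Λvν-unit
    Λw≡c²Λvν : Λ-at w 0ℤ ≡ c * c * Λvν
    Λw≡c²Λvν = trans
      (cong₂ (Λ P Q) (trans (w≡cv (+ 1)) (cong (λ m → c * v m) (ℤP.+-comm 1ℤ ν)))
                     (trans (w≡cv (+ 0)) (cong (λ m → c * v m) (ℤP.+-identityˡ ν))))
      (Λ-scale c (v (ν ℤ.+ 1ℤ)) (v ν))
    Λw*Λvν⁻¹≡c² : Λ-at w 0ℤ * Λvν⁻¹ ≡ c * c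
    Λw*Λvν⁻¹≡c² = begin
      Λ-at w 0ℤ * Λvν⁻¹       ≡⟨ cong (_* Λvν⁻¹) Λw≡c²Λvν ⟩
      c * c * Λvν * Λvν⁻¹     ≡⟨ ℚP.*-assoc (c * c) Λvν Λvν⁻¹ ⟩
      c * c * (Λvν * Λvν⁻¹)   ≡⟨ cong (c * c *_) (proj₂ (proj₂ (proj₂ Λvν-unit))) ⟩
      c * c * 1ℚ              ≡⟨ ℚP.*-identityʳ (c * c) ⟩
      c * c                   ∎
      where open ≡-Reasoning

  ρ-surjective : ∀ w → InK P Q p w → Σ Seq λ v → InS P Q ℤ₍ p ₎ v × G-eq ℚ-all v w
  ρ-surjective w (v , (_ , rec-v , _) , w∼v , a , b , v₁≡a , v₀≡b , _ , p∤Λ) =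
    v , InS-ℤ₍p₎-of-integral {v} a b rec-v v₁≡a v₀≡b (¬p∣ᵤ⇒¬p∣ {Λℤ P Q a b} p∤Λ) , G-eq-sym w∼v

  ρ-isIso : ρ-IsIso P Q p
  ρ-isIso = record
    { into-K       = InS-ℤ₍p₎⇒InK
    ; well-defined = λ _ _ _ _ → G-eq⇒G-eq-ℚ
    ; homomorphism = λ w v _ _ → G-eq-ℚ-refl (mul P Q w v)
    ; injective    = λ w v w∈ v∈ → λ { (c , _ , w≡cv) →
        c , scale-IsUnit {w} {v} c 0ℤ w∈ v∈ (shift-by-0 {w} {v} {c} w≡cv) , w≡cv }
    ; surjective   = λ w _ → ρ-surjective w
    }

  ρ*-isIso : ρ*-IsIso P Q p
  ρ*-isIso = record
    { into-K*      = InS-ℤ₍p₎⇒InK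
    ; well-defined = λ w v _ _ → G*-eq⇒G*-eq-ℚ {w = w} {v}
    ; homomorphism = λ w v _ _ → G-eq⇒G*-eq (G-eq-ℚ-refl (mul P Q w v))
    ; injective    = λ w v w∈ v∈ → λ { (c , _ , ν , w≡cv) →
        c , scale-IsUnit {w} {v} c ν w∈ v∈ w≡cv , ν , w≡cv }
    ; surjective   = λ w _ k∈ → let (v , v∈ , v∼w) = ρ-surjective w k∈ in v , v∈ , G-eq⇒G*-eq v∼w
    }

lemma4 : (P Q : ℤ) → Q ≢ + 0 → P ℤ.* P ℤ.- + 4 ℤ.* Q ≢ + 0 →
    (p : ℕ) → Prime p → ¬ ((+ p) ∣ Q) →
    ρ-IsIso P Q p × ρ*-IsIso P Q p
lemma4 P Q _ _ p p-prime p∤Q = ρ-isIso , ρ*-isIso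
  where open Isomorphism P Q p p-prime p∤Q
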